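{- Let $k\geq0$ be an integer and let $w$ be the chip configuration on $V_\infty$ defined by $w_{0,0}=-1$, $w_{2k+1,0}=1$, $w_{k-i,2i+1}=\frac{2k+1}{2i+1}\binom{k+i}{2i}$ for $i\in\{0,1,\dots,k\}$, and $w_{i,j}=0$ otherwise. Then $w$ is a valid outcome.
   Context: $V_\infty=\mathbb Z_{\geq0}^2$. A chip configuration is a finitely supported integer vector indexed by $V_\infty$. A splitting move at $p$ decreases $w_p$ by $1$ and increases $w_{p+(1,0)}$ and $w_{p+(0,1)}$ by $1$; an unsplitting move is its inverse; an outcome is a configuration reachable from the zero configuration by finitely many moves. $w$ is valid if $w_{i,j}\geq0$ for all $(i,j)\neq(0,0)$. -}

module Defs where

open import Data.Nat as ℕ using (ℕ; zero; suc; _≡ᵇ_; _≤ᵇ_)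
open import Data.Nat.DivMod using (_/_; _%_)
open import Data.Nat.Combinatorics using (_C_)
open import Data.Integer as ℤ using (ℤ; +_; -_; 0ℤ; 1ℤ; -1ℤ)
open import Data.Bool using (Bool; true; false; if_then_else_; _∧_)
open import Data.List using (List; []; _∷_; foldr)
open import Data.Product using (Σ; _×_)
open import Relation.Binary.PropositionalEquality using (_≡_)
open import Relation.Nullary using (¬_)

-- A chip configuration on V∞ = ℤ≥0²: an integer at every lattice point.
-- (Finite support is automatic for everything we consider: the zero
-- configuration, configurations obtained from it by moves, and the
-- explicit configuration of Corollary 8.3.)
Config : Set
Config = ℕ → ℕ → ℤ

zeroConfig : Config
zeroConfig _ _ = 0ℤ

δ : ℕ → ℕ → ℕ → ℕ → ℤ
δ a b i j = if (i ≡ᵇ a) ∧ (j ≡ᵇ b) then 1ℤ else 0ℤ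

splitAt : ℕ → ℕ → Config → Config
splitAt a b w i j = w i j ℤ.- δ a b i j ℤ.+ δ (suc a) b i j ℤ.+ δ a (suc b) i j

unsplitAt : ℕ → ℕ → Config → Config
unsplitAt a b w i j = w i j ℤ.+ δ a b i j ℤ.- δ (suc a) b i j ℤ.- δ a (suc b) i j

data Move : Set where
  split   : ℕ → ℕ → Move
  unsplit : ℕ → ℕ → Move

applyMove : Move → Config → Config
applyMove (split a b)   = splitAt a b
applyMove (unsplit a b) = unsplitAt a b

-- apply a finite sequence of moves (the last list element is applied first)
applyMoves : List Move → Config → Config
applyMoves ms w = foldr applyMove w ms

IsOutcome : Config → Set
IsOutcome w = Σ (List Move) λ ms → ∀ i j → applyMoves ms zeroConfig i j ≡ w i j

IsValid : Config → Set
IsValid w = ∀ i j → ¬ (i ≡ 0 × j ≡ 0) → 0ℤ ℤ.≤ w i j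

-- The quotient is an integer; it is computed as ((2k+1)·C(k+i,2i)) / (2i+1).
coeff : ℕ → ℕ → ℕ
coeff k i = ((2 ℕ.* k ℕ.+ 1) ℕ.* ((k ℕ.+ i) C (2 ℕ.* i))) / suc (2 ℕ.* i)

wCor : ℕ → Config
wCor k a zero =
  if a ≡ᵇ 0 then -1ℤ else (if a ≡ᵇ (2 ℕ.* k ℕ.+ 1) then 1ℤ else 0ℤ)
wCor k a (suc b) =
  if (b % 2 ≡ᵇ 0) ∧ ((b / 2) ≤ᵇ k) ∧ ((a ℕ.+ b / 2) ≡ᵇ k)
  then + coeff k (b / 2) else 0ℤ

-- Read a configuration w as the polynomial Σ w i j xⁱ yʲ. A split at (a, b) adds
-- xᵃ yᵇ (x + y − 1), so the outcomes form a ℤ-module that contains x + y − 1 and is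
-- closed under multiplication by x and y (shiftˣ, shiftʸ).
--
-- The Fibonacci polynomials F₀ = 0, F₁ = 1, F_{m+2} = x F_m + y F_{m+1} are
-- F_m = Σ_{2i+j = m−1} C(i+j, j) xⁱ yʲ, and the Lucas polynomials L_m = F_{m+2} + x F_m
-- satisfy the same recursion. On the line y = 1 − x its characteristic roots are 1 and
-- −x, which gives L_m(x, 1 − x) = 1 + (−x)^{m+1}. Hence Z_m = L_m − 1 + (−1)^m x^{m+1}
-- (reducedLucas m) should be a multiple of x + y − 1, and indeed Z₀ = x + y − 1,
-- Z₁ = (1 + y − x)(x + y − 1) and
-- Z_{m+2} = x Z_m + y Z_{m+1} + (x + y − 1)(1 + (−1)^m x^{m+2}), so every Z_m is an outcome.
--
-- Finally w = Z_{2k}: the coefficient of x^{k−i} y^{2i+1} in L_{2k} is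
-- C(k+i+1, 2i+1) + C(k+i, 2i+1) = (2k+1)/(2i+1) · C(k+i, 2i), and every coefficient of w
-- other than w₀₀ is nonnegative.

module Submission where

open import Defs
open import Data.Nat as ℕ using (ℕ; zero; suc; _≡ᵇ_; _≤ᵇ_)
import Data.Nat.Properties as ℕP
open import Data.Nat.DivMod using (_/_; _%_; m*n/n≡m)
open import Data.Nat.Combinatorics
  using (_C_; nCk+nC[k+1]≡[n+1]C[k+1]; nCn≡1; nC1≡n; k>n⇒nCk≡0)
import Data.Nat.Tactic.RingSolver as ℕ-Solver
import Data.Integer.Tactic.RingSolver as ℤ-Solver
open import Data.Integer using (ℤ; +_; -[1+_]; 0ℤ; 1ℤ; -1ℤ; _+_; _-_; -_; _*_; _≤_; +≤+)
import Data.Integer.Properties as ℤP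
open import Data.Bool using (true; false; if_then_else_)
open import Data.Bool.Properties using (∧-zeroʳ; ∧-identityʳ; T-≡)
open import Data.Empty using (⊥-elim)
open import Data.Sum using (_⊎_; inj₁; inj₂)
open import Data.List using ([]; _∷_; _++_; map)
open import Data.List.Properties using (foldr-++)
open import Data.Product using (Σ; _×_; _,_)
open import Relation.Binary.PropositionalEquality
import Algebra.Properties.CommutativeSemigroup as CommutativeSemigroupProperties
open import Relation.Nullary using (yes; no)
open import Function.Bundles using (Equivalence)

infix  4 _≗₂_
infixl 6 _⊕_
infixl 7 _⊛_

_≗₂_ : Config → Config → Set
F ≗₂ G = ∀ i j → F i j ≡ G i j

_⊕_ : Config → Config → Config
(F ⊕ G) i j = F i j + G i j

_⊛_ : ℤ → Config → Config
(c ⊛ F) i j = c * F i j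

shiftˣ : Config → Config
shiftˣ F zero    j = 0ℤ
shiftˣ F (suc i) j = F i j

shiftʸ : Config → Config
shiftʸ F i zero    = 0ℤ
shiftʸ F i (suc j) = F i j

shiftˣ-cong : ∀ {F G} → F ≗₂ G → shiftˣ F ≗₂ shiftˣ G
shiftˣ-cong F≗G zero    j = refl
shiftˣ-cong F≗G (suc i) j = F≗G i j

shiftʸ-cong : ∀ {F G} → F ≗₂ G → shiftʸ F ≗₂ shiftʸ G
shiftʸ-cong F≗G i zero    = refl
shiftʸ-cong F≗G i (suc j) = F≗G i j

shiftˣ-⊕ : ∀ F G → shiftˣ (F ⊕ G) ≗₂ shiftˣ F ⊕ shiftˣ G
shiftˣ-⊕ F G zero    j = refl
shiftˣ-⊕ F G (suc i) j = refl

shiftʸ-⊕ : ∀ F G → shiftʸ (F ⊕ G) ≗₂ shiftʸ F ⊕ shiftʸ G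
shiftʸ-⊕ F G i zero    = refl
shiftʸ-⊕ F G i (suc j) = refl

shiftˣ-shiftʸ : ∀ F → shiftˣ (shiftʸ F) ≗₂ shiftʸ (shiftˣ F)
shiftˣ-shiftʸ F zero    zero    = refl
shiftˣ-shiftʸ F zero    (suc j) = refl
shiftˣ-shiftʸ F (suc i) zero    = refl
shiftˣ-shiftʸ F (suc i) (suc j) = refl

δ-above-axis : ∀ a i j → δ a 0 i (suc j) ≡ 0ℤ
δ-above-axis a i j with i ≡ᵇ a
... | true  = refl
... | false = refl

δ-on-axis : ∀ a b i → δ a (suc b) i 0 ≡ 0ℤ
δ-on-axis a b i with i ≡ᵇ a
... | true  = refl
... | false = refl

-- Outcomes form a ℤ-module closed under multiplication by x and y

IsOutcome-resp : ∀ {F G} → F ≗₂ G → IsOutcome F → IsOutcome G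
IsOutcome-resp F≗G (ms , reach) = ms , λ i j → trans (reach i j) (F≗G i j)

IsOutcome-zero : IsOutcome zeroConfig
IsOutcome-zero = [] , λ i j → refl

IsOutcome-split : ∀ a b → IsOutcome (splitAt a b zeroConfig)
IsOutcome-split a b = split a b ∷ [] , λ i j → refl

applyMove-translation : ∀ m w i j →
  applyMove m w i j ≡ w i j + applyMove m zeroConfig i j
applyMove-translation (split a b)   w i j = split-identity (w i j) _ _ _
  where
  split-identity : ∀ x d p q → x - d + p + q ≡ x + (0ℤ - d + p + q)
  split-identity = ℤ-Solver.solve-∀
applyMove-translation (unsplit a b) w i j = unsplit-identity (w i j) _ _ _
  where
  unsplit-identity : ∀ x d p q → x + d - p - q ≡ x + (0ℤ + d - p - q)
  unsplit-identity = ℤ-Solver.solve-∀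

applyMoves-translation : ∀ ms w i j →
  applyMoves ms w i j ≡ w i j + applyMoves ms zeroConfig i j
applyMoves-translation []       w i j = sym (ℤP.+-identityʳ (w i j))
applyMoves-translation (m ∷ ms) w i j = begin
  applyMove m (applyMoves ms w) i j
    ≡⟨ applyMove-translation m _ i j ⟩
  applyMoves ms w i j + applyMove m zeroConfig i j
    ≡⟨ cong (_+ applyMove m zeroConfig i j) (applyMoves-translation ms w i j) ⟩
  w i j + applyMoves ms zeroConfig i j + applyMove m zeroConfig i j
    ≡⟨ ℤP.+-assoc (w i j) _ _ ⟩
  w i j + (applyMoves ms zeroConfig i j + applyMove m zeroConfig i j)
    ≡⟨ cong (λ x → w i j + x) (applyMove-translation m _ i j) ⟨
  w i j + applyMoves (m ∷ ms) zeroConfig i j ∎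
  where open ≡-Reasoning

IsOutcome-⊕ : ∀ {F G} → IsOutcome F → IsOutcome G → IsOutcome (F ⊕ G)
IsOutcome-⊕ {F} {G} (ms , reachF) (ms′ , reachG) = ms ++ ms′ , λ i j → begin
  applyMoves (ms ++ ms′) zeroConfig i j
    ≡⟨ cong (λ W → W i j) (foldr-++ applyMove zeroConfig ms ms′) ⟩
  applyMoves ms (applyMoves ms′ zeroConfig) i j
    ≡⟨ applyMoves-translation ms _ i j ⟩
  applyMoves ms′ zeroConfig i j + applyMoves ms zeroConfig i j
    ≡⟨ cong₂ _+_ (reachG i j) (reachF i j) ⟩
  G i j + F i j
    ≡⟨ ℤP.+-comm (G i j) (F i j) ⟩
  F i j + G i j ∎
  where open ≡-Reasoning

inverse : Move → Move
inverse (split a b)   = unsplit a b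
inverse (unsplit a b) = split a b

applyMoves-inverse : ∀ ms i j →
  applyMoves (map inverse ms) zeroConfig i j ≡ - applyMoves ms zeroConfig i j
applyMoves-inverse [] i j = refl
applyMoves-inverse (split a b ∷ ms) i j
  rewrite applyMoves-inverse ms i j = negated-split (applyMoves ms zeroConfig i j) _ _ _
  where
  negated-split : ∀ x d p q → - x + d - p - q ≡ - (x - d + p + q)
  negated-split = ℤ-Solver.solve-∀
applyMoves-inverse (unsplit a b ∷ ms) i j
  rewrite applyMoves-inverse ms i j = negated-unsplit (applyMoves ms zeroConfig i j) _ _ _
  where
  negated-unsplit : ∀ x d p q → - x - d + p + q ≡ - (x + d - p - q)
  negated-unsplit = ℤ-Solver.solve-∀

IsOutcome-neg : ∀ {F} → IsOutcome F → IsOutcome (-1ℤ ⊛ F)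
IsOutcome-neg {F} (ms , reach) = map inverse ms , λ i j →
  trans (applyMoves-inverse ms i j) (trans (cong -_ (reach i j)) (sym (ℤP.-1*i≡-i (F i j))))

IsOutcome-+⊛ : ∀ n {F} → IsOutcome F → IsOutcome (+ n ⊛ F)
IsOutcome-+⊛ zero    {F} _    = IsOutcome-resp (λ i j → sym (ℤP.*-zeroˡ (F i j)))
  IsOutcome-zero
IsOutcome-+⊛ (suc n) {F} outF = IsOutcome-resp (λ i j → sym (ℤP.suc-* (+ n) (F i j)))
  (IsOutcome-⊕ outF (IsOutcome-+⊛ n outF))

IsOutcome-⊛ : ∀ c {F} → IsOutcome F → IsOutcome (c ⊛ F)
IsOutcome-⊛ (+ n)          outF = IsOutcome-+⊛ n outF
IsOutcome-⊛ -[1+ n ] {F} outF = IsOutcome-resp (λ i j → begin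
  -1ℤ * (+ suc n * F i j) ≡⟨ ℤP.-1*i≡-i _ ⟩
  - (+ suc n * F i j)     ≡⟨ ℤP.neg-distribˡ-* (+ suc n) (F i j) ⟩
  -[1+ n ] * F i j        ∎)
  (IsOutcome-neg (IsOutcome-+⊛ (suc n) outF))
  where open ≡-Reasoning

moveˣ : Move → Move
moveˣ (split a b)   = split (suc a) b
moveˣ (unsplit a b) = unsplit (suc a) b

moveʸ : Move → Move
moveʸ (split a b)   = split a (suc b)
moveʸ (unsplit a b) = unsplit a (suc b)

applyMoves-moveˣ : ∀ ms →
  applyMoves (map moveˣ ms) zeroConfig ≗₂ shiftˣ (applyMoves ms zeroConfig)
applyMoves-moveˣ []                 zero    j = refl
applyMoves-moveˣ []                 (suc i) j = refl
applyMoves-moveˣ (split a b ∷ ms)   zero    j rewrite applyMoves-moveˣ ms zero j    = refl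
applyMoves-moveˣ (split a b ∷ ms)   (suc i) j rewrite applyMoves-moveˣ ms (suc i) j = refl
applyMoves-moveˣ (unsplit a b ∷ ms) zero    j rewrite applyMoves-moveˣ ms zero j    = refl
applyMoves-moveˣ (unsplit a b ∷ ms) (suc i) j rewrite applyMoves-moveˣ ms (suc i) j = refl

applyMoves-moveʸ : ∀ ms →
  applyMoves (map moveʸ ms) zeroConfig ≗₂ shiftʸ (applyMoves ms zeroConfig)
applyMoves-moveʸ []                 i zero    = refl
applyMoves-moveʸ []                 i (suc j) = refl
applyMoves-moveʸ (split a b ∷ ms)   i zero
  rewrite applyMoves-moveʸ ms i zero | δ-on-axis a b i | δ-on-axis (suc a) b i = refl
applyMoves-moveʸ (split a b ∷ ms)   i (suc j) rewrite applyMoves-moveʸ ms i (suc j) = refl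
applyMoves-moveʸ (unsplit a b ∷ ms) i zero
  rewrite applyMoves-moveʸ ms i zero | δ-on-axis a b i | δ-on-axis (suc a) b i = refl
applyMoves-moveʸ (unsplit a b ∷ ms) i (suc j) rewrite applyMoves-moveʸ ms i (suc j) = refl

IsOutcome-shiftˣ : ∀ {F} → IsOutcome F → IsOutcome (shiftˣ F)
IsOutcome-shiftˣ (ms , reach) = map moveˣ ms , λ i j →
  trans (applyMoves-moveˣ ms i j) (shiftˣ-cong reach i j)

IsOutcome-shiftʸ : ∀ {F} → IsOutcome F → IsOutcome (shiftʸ F)
IsOutcome-shiftʸ (ms , reach) = map moveʸ ms , λ i j →
  trans (applyMoves-moveʸ ms i j) (shiftʸ-cong reach i j)

-- Fibonacci and Lucas polynomials

-- Used instead of 2 * n so that the support condition of fib reduces under suc.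
double : ℕ → ℕ
double zero    = zero
double (suc n) = suc (suc (double n))

fib : ℕ → Config
fib zero    i j = 0ℤ
fib (suc m) i j = if double i ℕ.+ j ≡ᵇ m then + ((i ℕ.+ j) C j) else 0ℤ

fib-rec : ∀ m → fib (suc (suc m)) ≗₂ shiftˣ (fib m) ⊕ shiftʸ (fib (suc m))
fib-rec m             zero    zero    = refl
fib-rec m             zero    (suc j) with j ≡ᵇ m
... | true  = cong +_ (trans (nCn≡1 (suc j)) (sym (nCn≡1 j)))
... | false = refl
fib-rec zero          (suc i) zero    = refl
fib-rec (suc m)       (suc i) zero    with double i ℕ.+ 0 ≡ᵇ m
... | true  = refl
... | false = refl
fib-rec zero          (suc i) (suc j) = refl
fib-rec (suc zero)    (suc i) (suc j) rewrite ℕP.+-suc (double i) j = refl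
fib-rec (suc (suc m)) (suc i) (suc j)
  rewrite ℕP.+-suc (double i) j | ℕP.+-suc i j with double i ℕ.+ j ≡ᵇ m
... | true  = cong +_ (begin
  suc n C suc j                 ≡⟨ nCk+nC[k+1]≡[n+1]C[k+1] n j ⟨
  n C j ℕ.+ n C suc j           ≡⟨ ℕP.+-comm (n C j) (n C suc j) ⟩
  n C suc j ℕ.+ n C j           ∎)
  where
  open ≡-Reasoning
  n = suc (i ℕ.+ j)
... | false = refl

lucas : ℕ → Config
lucas m = fib (suc (suc m)) ⊕ shiftˣ (fib m)

lucas-rec : ∀ m → lucas (suc (suc m)) ≗₂ shiftˣ (lucas m) ⊕ shiftʸ (lucas (suc m))
lucas-rec m i j = begin
  fib (suc (suc (suc (suc m)))) i j + shiftˣ (fib (suc (suc m))) i j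
    ≡⟨ cong₂ _+_ (fib-rec (suc (suc m)) i j) (shiftˣ-cong (fib-rec m) i j) ⟩
  (a + b) + shiftˣ (shiftˣ (fib m) ⊕ shiftʸ (fib (suc m))) i j
    ≡⟨ cong (λ x → (a + b) + x) (shiftˣ-⊕ (shiftˣ (fib m)) _ i j) ⟩
  (a + b) + (c + shiftˣ (shiftʸ (fib (suc m))) i j)
    ≡⟨ cong (λ x → (a + b) + (c + x)) (shiftˣ-shiftʸ (fib (suc m)) i j) ⟩
  (a + b) + (c + d)
    ≡⟨ interchange a b c d ⟩
  (a + c) + (b + d)
    ≡⟨ cong₂ _+_ (shiftˣ-⊕ (fib (suc (suc m))) _ i j)
                 (shiftʸ-⊕ (fib (suc (suc (suc m)))) _ i j) ⟨
  shiftˣ (lucas m) i j + shiftʸ (lucas (suc m)) i j ∎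
  where
  open ≡-Reasoning
  open CommutativeSemigroupProperties ℤP.+-commutativeSemigroup using (interchange)
  a = shiftˣ (fib (suc (suc m))) i j
  b = shiftʸ (fib (suc (suc (suc m)))) i j
  c = shiftˣ (shiftˣ (fib m)) i j
  d = shiftʸ (shiftˣ (fib (suc m))) i j

sign : ℕ → ℤ
sign zero    = 1ℤ
sign (suc n) = - sign n

sign-double : ∀ k → sign (double k) ≡ 1ℤ
sign-double zero    = refl
sign-double (suc k) = trans (ℤP.neg-involutive (sign (double k))) (sign-double k)

reducedLucas : ℕ → Config
reducedLucas m = lucas m ⊕ -1ℤ ⊛ δ 0 0 ⊕ sign m ⊛ δ (suc m) 0

shiftˣ-reducedLucas : ∀ m → shiftˣ (reducedLucas m) ≗₂
  shiftˣ (lucas m) ⊕ -1ℤ ⊛ δ 1 0 ⊕ sign m ⊛ δ (suc (suc m)) 0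
shiftˣ-reducedLucas m zero    j = sym (trans (ℤP.+-identityˡ _) (ℤP.*-zeroʳ (sign m)))
shiftˣ-reducedLucas m (suc i) j = refl

shiftʸ-reducedLucas : ∀ m → shiftʸ (reducedLucas (suc m)) ≗₂
  shiftʸ (lucas (suc m)) ⊕ -1ℤ ⊛ δ 0 1 ⊕ sign (suc m) ⊛ δ (suc (suc m)) 1
shiftʸ-reducedLucas m i zero rewrite δ-on-axis 0 0 i | δ-on-axis (suc (suc m)) 0 i =
  sym (trans (ℤP.+-identityˡ _) (ℤP.*-zeroʳ (sign (suc m))))
shiftʸ-reducedLucas m i (suc j) = refl

reducedLucas-rec : ∀ m → reducedLucas (suc (suc m)) ≗₂
  shiftˣ (reducedLucas m) ⊕ shiftʸ (reducedLucas (suc m))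
    ⊕ splitAt 0 0 zeroConfig ⊕ sign m ⊛ splitAt (suc (suc m)) 0 zeroConfig
reducedLucas-rec m i j
  rewrite lucas-rec m i j | shiftˣ-reducedLucas m i j | shiftʸ-reducedLucas m i j =
  regroup (shiftˣ (lucas m) i j) (shiftʸ (lucas (suc m)) i j) (sign m) (δ 0 0 i j) _ _ _ _ _
  where
  regroup : ∀ A B s d₀₀ d₁₀ d₀₁ d₂₀ d₃₀ d₂₁ →
    A + B + -1ℤ * d₀₀ + - - s * d₃₀ ≡
    (A + -1ℤ * d₁₀ + s * d₂₀) + (B + -1ℤ * d₀₁ + - s * d₂₁)
      + (0ℤ - d₀₀ + d₁₀ + d₀₁) + s * (0ℤ - d₂₀ + d₃₀ + d₂₁)
  regroup = ℤ-Solver.solve-∀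

reducedLucas-0 : reducedLucas 0 ≗₂ splitAt 0 0 zeroConfig
reducedLucas-0 zero          zero          = refl
reducedLucas-0 zero          (suc zero)    = refl
reducedLucas-0 zero          (suc (suc j)) = refl
reducedLucas-0 (suc zero)    zero          = refl
reducedLucas-0 (suc zero)    (suc zero)    = refl
reducedLucas-0 (suc zero)    (suc (suc j)) = refl
reducedLucas-0 (suc (suc i)) j             = refl

reducedLucas-1 :
  reducedLucas 1 ≗₂ applyMoves (split 0 0 ∷ split 0 1 ∷ unsplit 1 0 ∷ []) zeroConfig
reducedLucas-1 zero                zero                = refl
reducedLucas-1 zero                (suc zero)          = refl
reducedLucas-1 zero                (suc (suc zero))    = refl
reducedLucas-1 zero                (suc (suc (suc j))) = refl
reducedLucas-1 (suc zero)          zero                = refl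
reducedLucas-1 (suc zero)          (suc zero)          = refl
reducedLucas-1 (suc zero)          (suc (suc zero))    = refl
reducedLucas-1 (suc zero)          (suc (suc (suc j))) = refl
reducedLucas-1 (suc (suc zero))    zero                = refl
reducedLucas-1 (suc (suc zero))    (suc zero)          = refl
reducedLucas-1 (suc (suc zero))    (suc (suc zero))    = refl
reducedLucas-1 (suc (suc zero))    (suc (suc (suc j))) = refl
reducedLucas-1 (suc (suc (suc i))) j                   = refl

IsOutcome-reducedLucas : ∀ m → IsOutcome (reducedLucas m)
IsOutcome-reducedLucas zero          =
  IsOutcome-resp (λ i j → sym (reducedLucas-0 i j)) (IsOutcome-split 0 0)
IsOutcome-reducedLucas (suc zero)    =
  split 0 0 ∷ split 0 1 ∷ unsplit 1 0 ∷ [] , λ i j → sym (reducedLucas-1 i j)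
IsOutcome-reducedLucas (suc (suc m)) = IsOutcome-resp (λ i j → sym (reducedLucas-rec m i j))
  (IsOutcome-⊕ (IsOutcome-⊕ (IsOutcome-⊕ (IsOutcome-shiftˣ (IsOutcome-reducedLucas m))
                                         (IsOutcome-shiftʸ (IsOutcome-reducedLucas (suc m))))
                            (IsOutcome-split 0 0))
               (IsOutcome-⊛ (sign m) (IsOutcome-split (suc (suc m)) 0)))

-- Coefficients of the Lucas polynomials and of w

[k+1]*[n+1]C[k+1]≡[n+1]*nCk : ∀ n k → suc k ℕ.* (suc n C suc k) ≡ suc n ℕ.* (n C k)
[k+1]*[n+1]C[k+1]≡[n+1]*nCk zero    zero    = refl
[k+1]*[n+1]C[k+1]≡[n+1]*nCk zero    (suc k) = ℕP.*-zeroʳ (suc (suc k))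
[k+1]*[n+1]C[k+1]≡[n+1]*nCk (suc n) zero    =
  trans (ℕP.+-identityʳ _) (trans (nC1≡n (suc (suc n))) (sym (ℕP.*-identityʳ _)))
[k+1]*[n+1]C[k+1]≡[n+1]*nCk (suc n) (suc k) = begin
  suc (suc k) ℕ.* (suc N C suc (suc k))
    ≡⟨ cong (suc (suc k) ℕ.*_) (nCk+nC[k+1]≡[n+1]C[k+1] N (suc k)) ⟨
  suc (suc k) ℕ.* (N C suc k ℕ.+ N C suc (suc k))
    ≡⟨ regroup k (N C suc k) (N C suc (suc k)) ⟩
  suc k ℕ.* (N C suc k) ℕ.+ suc (suc k) ℕ.* (N C suc (suc k)) ℕ.+ N C suc k
    ≡⟨ cong₂ (λ x y → x ℕ.+ y ℕ.+ N C suc k)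
         ([k+1]*[n+1]C[k+1]≡[n+1]*nCk n k) ([k+1]*[n+1]C[k+1]≡[n+1]*nCk n (suc k)) ⟩
  N ℕ.* (n C k) ℕ.+ N ℕ.* (n C suc k) ℕ.+ N C suc k
    ≡⟨ cong (ℕ._+ N C suc k) (ℕP.*-distribˡ-+ N (n C k) (n C suc k)) ⟨
  N ℕ.* (n C k ℕ.+ n C suc k) ℕ.+ N C suc k
    ≡⟨ cong (λ x → N ℕ.* x ℕ.+ N C suc k) (nCk+nC[k+1]≡[n+1]C[k+1] n k) ⟩
  N ℕ.* (N C suc k) ℕ.+ N C suc k
    ≡⟨ ℕP.+-comm (N ℕ.* (N C suc k)) _ ⟩
  suc N ℕ.* (N C suc k) ∎
  where
  open ≡-Reasoning
  N = suc n
  regroup : ∀ k x y →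
    suc (suc k) ℕ.* (x ℕ.+ y) ≡ suc k ℕ.* x ℕ.+ suc (suc k) ℕ.* y ℕ.+ x
  regroup = ℕ-Solver.solve-∀

-- (2n + 1 − m) · C(n, m) = (m + 1) · (C(n + 1, m + 1) + C(n, m + 1)), with
-- (m + 1) · C(n, m) added to both sides so that no subtraction occurs.
odd-binomial-identity : ∀ n m →
  suc m ℕ.* (suc n C suc m ℕ.+ n C suc m) ℕ.+ suc m ℕ.* (n C m) ≡ 2 ℕ.* (suc n ℕ.* (n C m))
odd-binomial-identity n m = begin
  suc m ℕ.* (B ℕ.+ n C suc m) ℕ.+ suc m ℕ.* (n C m)
    ≡⟨ regroup m B (n C suc m) (n C m) ⟩
  suc m ℕ.* B ℕ.+ suc m ℕ.* (n C m ℕ.+ n C suc m)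
    ≡⟨ cong (λ x → suc m ℕ.* B ℕ.+ suc m ℕ.* x) (nCk+nC[k+1]≡[n+1]C[k+1] n m) ⟩
  suc m ℕ.* B ℕ.+ suc m ℕ.* B
    ≡⟨ cong (λ x → x ℕ.+ x) ([k+1]*[n+1]C[k+1]≡[n+1]*nCk n m) ⟩
  suc n ℕ.* (n C m) ℕ.+ suc n ℕ.* (n C m)
    ≡⟨ twice (suc n ℕ.* (n C m)) ⟩
  2 ℕ.* (suc n ℕ.* (n C m)) ∎
  where
  open ≡-Reasoning
  B = suc n C suc m
  regroup : ∀ m b c d →
    suc m ℕ.* (b ℕ.+ c) ℕ.+ suc m ℕ.* d ≡ suc m ℕ.* b ℕ.+ suc m ℕ.* (d ℕ.+ c)
  regroup = ℕ-Solver.solve-∀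
  twice : ∀ x → x ℕ.+ x ≡ 2 ℕ.* x
  twice = ℕ-Solver.solve-∀

coeff-binomial : ∀ k q →
  coeff k q ≡ suc (k ℕ.+ q) C suc (2 ℕ.* q) ℕ.+ (k ℕ.+ q) C suc (2 ℕ.* q)
coeff-binomial k q = trans (cong (_/ suc m) numerator) (m*n/n≡m _ (suc m))
  where
  n = k ℕ.+ q
  m = 2 ℕ.* q
  S = suc n C suc m ℕ.+ n C suc m
  regroup : ∀ k q c →
    (2 ℕ.* k ℕ.+ 1) ℕ.* c ℕ.+ suc (2 ℕ.* q) ℕ.* c ≡ 2 ℕ.* (suc (k ℕ.+ q) ℕ.* c)
  regroup = ℕ-Solver.solve-∀
  numerator : (2 ℕ.* k ℕ.+ 1) ℕ.* (n C m) ≡ S ℕ.* suc m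
  numerator = ℕP.+-cancelʳ-≡ (suc m ℕ.* (n C m)) _ _ (begin
    (2 ℕ.* k ℕ.+ 1) ℕ.* (n C m) ℕ.+ suc m ℕ.* (n C m)
      ≡⟨ regroup k q (n C m) ⟩
    2 ℕ.* (suc n ℕ.* (n C m))
      ≡⟨ odd-binomial-identity n m ⟨
    suc m ℕ.* S ℕ.+ suc m ℕ.* (n C m)
      ≡⟨ cong (ℕ._+ suc m ℕ.* (n C m)) (ℕP.*-comm (suc m) S) ⟩
    S ℕ.* suc m ℕ.+ suc m ℕ.* (n C m) ∎)
    where open ≡-Reasoning

≡ᵇ-refl : ∀ n → (n ≡ᵇ n) ≡ true
≡ᵇ-refl zero    = refl
≡ᵇ-refl (suc n) = ≡ᵇ-refl n

double-injective : ∀ {m n} → double m ≡ double n → m ≡ n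
double-injective {zero}  {zero}  _ = refl
double-injective {suc m} {suc n} e =
  cong suc (double-injective (ℕP.suc-injective (ℕP.suc-injective e)))

suc-double≢double : ∀ m n → suc (double m) ≢ double n
suc-double≢double (suc m) (suc n) e =
  suc-double≢double m n (ℕP.suc-injective (ℕP.suc-injective e))

double-distrib-+ : ∀ m n → double m ℕ.+ double n ≡ double (m ℕ.+ n)
double-distrib-+ zero    n = refl
double-distrib-+ (suc m) n = cong (λ x → suc (suc x)) (double-distrib-+ m n)

double-+-suc-double : ∀ a q → double a ℕ.+ suc (double q) ≡ suc (double (a ℕ.+ q))
double-+-suc-double a q =
  trans (ℕP.+-suc (double a) (double q)) (cong suc (double-distrib-+ a q))

double≡2* : ∀ n → double n ≡ 2 ℕ.* n
double≡2* zero    = refl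
double≡2* (suc n) =
  trans (cong (λ x → suc (suc x)) (double≡2* n)) (cong suc (sym (ℕP.+-suc n (n ℕ.+ 0))))

double%2≡0 : ∀ q → double q % 2 ≡ 0
double%2≡0 zero    = refl
double%2≡0 (suc q) = double%2≡0 q

suc-double%2≡1 : ∀ q → suc (double q) % 2 ≡ 1
suc-double%2≡1 zero    = refl
suc-double%2≡1 (suc q) = suc-double%2≡1 q

double/2≡n : ∀ q → double q / 2 ≡ q
double/2≡n q = trans (cong (_/ 2) (trans (double≡2* q) (ℕP.*-comm 2 q))) (m*n/n≡m q 2)

even-or-odd : ∀ n → Σ ℕ (λ q → n ≡ double q) ⊎ Σ ℕ (λ q → n ≡ suc (double q))
even-or-odd zero = inj₁ (0 , refl)
even-or-odd (suc n) with even-or-odd n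
... | inj₁ (q , e) = inj₂ (q , cong suc e)
... | inj₂ (q , e) = inj₁ (suc q , cong suc e)

fib-coefficient : ∀ i j → fib (suc (double i ℕ.+ j)) i j ≡ + ((i ℕ.+ j) C j)
fib-coefficient i j rewrite ≡ᵇ-refl (double i ℕ.+ j) = refl

fib-coefficient-odd : ∀ a j →
  fib (suc (suc (double a ℕ.+ j))) a (suc j) ≡ + (suc (a ℕ.+ j) C suc j)
fib-coefficient-odd a j = subst₂ (λ m n → fib (suc m) a (suc j) ≡ + (n C suc j))
  (ℕP.+-suc (double a) j) (ℕP.+-suc a j) (fib-coefficient a (suc j))

fib-support : ∀ m i j → suc (double i ℕ.+ j) ≢ m → fib m i j ≡ 0ℤ
fib-support zero    i j _ = refl
fib-support (suc m) i j off with double i ℕ.+ j ≡ᵇ m in eq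
... | true  = ⊥-elim (off (cong suc (ℕP.≡ᵇ⇒≡ _ m (Equivalence.from T-≡ eq))))
... | false = refl

lucas-support : ∀ m a j → double a ℕ.+ j ≢ suc m → lucas m a j ≡ 0ℤ
lucas-support m a j off = cong₂ _+_
  (fib-support (suc (suc m)) a j (λ e → off (ℕP.suc-injective e)))
  (shifted a off)
  where
  shifted : ∀ a → double a ℕ.+ j ≢ suc m → shiftˣ (fib m) a j ≡ 0ℤ
  shifted zero    _   = refl
  shifted (suc a) off = fib-support m a j (λ e → off (cong suc e))

lucas-coefficient : ∀ a j →
  lucas (double a ℕ.+ j) a (suc j) ≡ + (suc (a ℕ.+ j) C suc j ℕ.+ (a ℕ.+ j) C suc j)
lucas-coefficient a j = cong₂ _+_ (fib-coefficient-odd a j) (shifted a)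
  where
  shifted : ∀ a → shiftˣ (fib (double a ℕ.+ j)) a (suc j) ≡ + ((a ℕ.+ j) C suc j)
  shifted zero    = cong +_ (sym (k>n⇒nCk≡0 (ℕP.n<1+n j)))
  shifted (suc a) = fib-coefficient-odd a j

lucas-axis : ∀ k a → lucas (double k) a 0 ≡ 0ℤ
lucas-axis k a = lucas-support (double k) a 0 λ e →
  suc-double≢double k a (sym (trans (sym (ℕP.+-identityʳ (double a))) e))

lucas-even-height : ∀ k a q → lucas (double k) a (suc (suc (double q))) ≡ 0ℤ
lucas-even-height k a q = lucas-support (double k) a _ λ e →
  suc-double≢double k (a ℕ.+ suc q) (sym (trans (sym (double-distrib-+ a (suc q))) e))

lucas-odd-height-off : ∀ k a q → a ℕ.+ q ≢ k → lucas (double k) a (suc (double q)) ≡ 0ℤ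
lucas-odd-height-off k a q off = lucas-support (double k) a _ λ e →
  off (double-injective (ℕP.suc-injective (trans (sym (double-+-suc-double a q)) e)))

coeff-as-lucas-coefficient : ∀ a q →
  coeff (a ℕ.+ q) q ≡ suc (a ℕ.+ double q) C suc (double q) ℕ.+ (a ℕ.+ double q) C suc (double q)
coeff-as-lucas-coefficient a q rewrite double≡2* q =
  subst (λ n → coeff (a ℕ.+ q) q ≡ suc n C suc (2 ℕ.* q) ℕ.+ n C suc (2 ℕ.* q))
    (reassociate a q) (coeff-binomial (a ℕ.+ q) q)
  where
  reassociate : ∀ a q → a ℕ.+ q ℕ.+ q ≡ a ℕ.+ 2 ℕ.* q
  reassociate = ℕ-Solver.solve-∀

lucas-odd-height-on : ∀ a q → lucas (double (a ℕ.+ q)) a (suc (double q)) ≡ + coeff (a ℕ.+ q) q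
lucas-odd-height-on a q = begin
  lucas (double (a ℕ.+ q)) a (suc (double q))
    ≡⟨ cong (λ m → lucas m a (suc (double q))) (double-distrib-+ a q) ⟨
  lucas (double a ℕ.+ double q) a (suc (double q))
    ≡⟨ lucas-coefficient a (double q) ⟩
  + (suc (a ℕ.+ double q) C suc (double q) ℕ.+ (a ℕ.+ double q) C suc (double q))
    ≡⟨ cong +_ (coeff-as-lucas-coefficient a q) ⟨
  + coeff (a ℕ.+ q) q ∎
  where open ≡-Reasoning

reducedLucas-above-axis : ∀ m a b → reducedLucas m a (suc b) ≡ lucas m a (suc b)
reducedLucas-above-axis m a b
  rewrite δ-above-axis 0 a b | δ-above-axis (suc m) a b | ℤP.*-zeroʳ (sign m)
        | ℤP.+-identityʳ (lucas m a (suc b)) = ℤP.+-identityʳ (lucas m a (suc b))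

wCor-odd-height-on : ∀ a q → wCor (a ℕ.+ q) a (suc (double q)) ≡ + coeff (a ℕ.+ q) q
wCor-odd-height-on a q
  rewrite double%2≡0 q | double/2≡n q | ≡ᵇ-refl (a ℕ.+ q)
        | Equivalence.to T-≡ (ℕP.≤⇒≤ᵇ (ℕP.m≤n+m q a)) = refl

wCor-odd-height-off : ∀ k a q → a ℕ.+ q ≢ k → wCor k a (suc (double q)) ≡ 0ℤ
wCor-odd-height-off k a q off rewrite double%2≡0 q | double/2≡n q with a ℕ.+ q ≡ᵇ k in eq
... | true  = ⊥-elim (off (ℕP.≡ᵇ⇒≡ (a ℕ.+ q) k (Equivalence.from T-≡ eq)))
... | false rewrite ∧-zeroʳ (q ≤ᵇ k) = refl

wCor-even-height : ∀ k a q → wCor k a (suc (suc (double q))) ≡ 0ℤ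
wCor-even-height k a q rewrite suc-double%2≡1 q = refl

wCor≗reducedLucas : ∀ k → wCor k ≗₂ reducedLucas (double k)
wCor≗reducedLucas k a zero rewrite lucas-axis k a | sign-double k = axis a
  where
  axis : ∀ a → wCor k a 0 ≡ 0ℤ + -1ℤ * δ 0 0 a 0 + 1ℤ * δ (suc (double k)) 0 a 0
  axis zero = refl
  axis (suc a)
    rewrite ℕP.+-comm (2 ℕ.* k) 1 | sym (double≡2* k) | ∧-identityʳ (a ≡ᵇ double k)
    with a ≡ᵇ double k
  ... | true  = refl
  ... | false = refl
wCor≗reducedLucas k a (suc b) rewrite reducedLucas-above-axis (double k) a b with even-or-odd b
... | inj₂ (q , refl) = trans (wCor-even-height k a q) (sym (lucas-even-height k a q))
... | inj₁ (q , refl) with a ℕ.+ q ℕ.≟ k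
...   | yes refl = trans (wCor-odd-height-on a q) (sym (lucas-odd-height-on a q))
...   | no off   = trans (wCor-odd-height-off k a q off) (sym (lucas-odd-height-off k a q off))

0≤if : ∀ c m n → 0ℤ ≤ (if c then + m else + n)
0≤if true  m n = +≤+ ℕ.z≤n
0≤if false m n = +≤+ ℕ.z≤n

wCor-valid : ∀ k → IsValid (wCor k)
wCor-valid k zero    zero    off = ⊥-elim (off (refl , refl))
wCor-valid k (suc i) zero    _   = 0≤if (suc i ≡ᵇ 2 ℕ.* k ℕ.+ 1) 1 0
wCor-valid k i       (suc b) _   = 0≤if _ _ 0

corollary8p3 : (k : ℕ) → IsValid (wCor k) × IsOutcome (wCor k)
corollary8p3 k = wCor-valid k ,
  IsOutcome-resp (λ i j → sym (wCor≗reducedLucas k i j)) (IsOutcome-reducedLucas (double k))
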